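{- Let $(I,\preceq)$ be a finite poset with $|I|=n$, and for each $i\in I$ let $G_i$ be a finite group with a symmetric generating set $S_i$, $1_{G_i}\notin S_i$. For $i\in I$ let $A(i)=\{j\in I: j\succ i\}$. Let $F$ be the set of tuples $f=(f_i)_{i\in I}$ with $f_i:\prod_{j\in A(i)}G_j\to G_i$ (for $A(i)=\emptyset$, $f_i$ is identified with an element of $G_i$). Let $G$ be the generalized wreath product group (the group $F$ with the operation described in the context). For $i\in I$ and $s_i\in S_i$, let $\overline{f_{i,s_i}}\in F$ be the tuple whose $q$-th component, for $q\neq i$, is the constant function with value $1_{G_q}$, and whose $i$-th component $\overline{s_i}$ takes the value $s_i$ at the point $(1_{G_j})_{j\in A(i)}$ and the value $1_{G_i}$ at every other point. Let $S=\{\overline{f_{i,s_i}}: i\in I,\ s_i\in S_i\}$. Then $S$ generates $G$, and the generalized wreath product graph $\mathcal{G}$ of the graphs $Cay(G_i,S_i)$, $i\in I$ (defined in the context), coincides with the Cayley graph $Cay(G,S)$.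
   Context: Cayley graph: for a finite group $H$ and a symmetric generating set $T$ with $1_H\notin T$, $Cay(H,T)$ has vertex set $H$ and $h\sim h'$ iff $h'=ht$ for some $t\in T$. Generalized wreath product group: let $X=\prod_{i\in I}G_i$; for $x\in X$ and $J\subseteq I$ write $x_J=(x_j)_{j\in J}$. An element $f=(f_i)_{i\in I}\in F$ acts on $X$ on the right by $xf=y$ with $y_i=x_i\cdot f_i(x_{A(i)})$ for each $i\in I$ (each $G_i$ acting on itself by right multiplication). This action is faithful, and $G$ is $F$ with the group structure of composition of these permutations, written on the right: $x(fh)=(xf)h$. Generalized wreath product graph $\mathcal{G}$: its vertex set is $F$. For a vertex $f\in F$ define elements $e_j(f)\in G_j$, $j\in I$, recursively (starting from indices with empty $A(j)$; well defined since $A(j)$ consists of strictly larger elements in a finite poset) by $e_j(f)=f_j\big((e_k(f)^{ -1})_{k\in A(j)}\big)$. Two vertices $f,h\in F$ are adjacent iff there exists $i\in I$ such that: (1) $f_j=h_j$ as functions for every $j\neq i$; and (2) $f_i$ and $h_i$ agree at every point of $\prod_{j\in A(i)}G_j$ except possibly $p=(e_k(f)^{ -1})_{k\in A(i)}$, and $f_i(p)$ and $h_i(p)$ are adjacent in $Cay(G_i,S_i)$ (when $A(i)=\emptyset$ this means $f_i\sim h_i$ in $Cay(G_i,S_i)$). -}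

module Defs where

open import Level using (0ℓ)
open import Data.Nat using (ℕ; zero; suc)
open import Data.Fin using (Fin; zero; suc)
import Data.Fin as Fin
open import Data.Bool using (Bool; true; false; not; _∧_)
open import Data.Unit using (⊤; tt)
open import Data.Product using (Σ; ∃; _×_; _,_; proj₁; proj₂; Σ-syntax; ∃-syntax)
open import Data.List using (List; []; _∷_; foldr; foldl)
open import Relation.Nullary using (¬_; Dec; yes; no; does)
open import Relation.Binary using (Rel; IsDecPartialOrder; DecidableEquality)
open import Relation.Binary.PropositionalEquality using (_≡_; refl; _≢_)
open import Algebra.Structures using (IsGroup)
open import Function.Bundles using (_↔_)

record FinGroup : Set₁ where
  infixl 7 _∙_
  field
    Carrier : Set
    _∙_     : Carrier → Carrier → Carrier
    ε       : Carrier
    _⁻¹     : Carrier → Carrier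
    isGroup : IsGroup _≡_ _∙_ ε _⁻¹
    _≟_     : DecidableEquality Carrier
    size    : ℕ
    enum    : Carrier ↔ Fin size

-- S is a symmetric generating set of the finite group H with 1 ∉ S.
-- (Generation by products of elements of S; since S is symmetric this is
--  the same as generation of H as a group.)
record IsSymGenSet (H : FinGroup) (S : FinGroup.Carrier H → Set) : Set where
  open FinGroup H
  field
    symmetric  : ∀ s → S s → S (s ⁻¹)
    noIdentity : ¬ S ε
    generates  : ∀ g → Σ[ ws ∈ List (Σ Carrier S) ]
                   g ≡ foldr (λ w acc → proj₁ w ∙ acc) ε ws

-- Dependent tuples indexed by Fin n (so that tuples have propositional
-- equality, i.e. elements of finite products ∏ G_j)

Tup : (n : ℕ) → (Fin n → Set) → Set
Tup zero    A = ⊤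
Tup (suc n) A = A zero × Tup n (λ j → A (suc j))

tab : ∀ {n} {A : Fin n → Set} → ((j : Fin n) → A j) → Tup n A
tab {zero}  g = tt
tab {suc n} g = g zero , tab (λ j → g (suc j))

get : ∀ {n} {A : Fin n → Set} → Tup n A → (j : Fin n) → A j
get {suc n} (a , _) zero    = a
get {suc n} (_ , t) (suc j) = get t j

decTup : ∀ {n} {A : Fin n → Set} → ((j : Fin n) → DecidableEquality (A j)) →
         DecidableEquality (Tup n A)
decTup {zero}  d tt tt = yes refl
decTup {suc n} d (a , t) (b , u) with d zero a b | decTup (λ j → d (suc j)) t u
... | yes refl | yes refl = yes refl
... | no ne    | _        = no λ { refl → ne refl }
... | yes _    | no ne    = no λ { refl → ne refl }

Opt : Bool → Set → Set
Opt true  A = A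
Opt false A = ⊤

opt : ∀ b {A : Set} → A → Opt b A
opt true  a = a
opt false _ = tt

decOpt : ∀ b {A : Set} → DecidableEquality A → DecidableEquality (Opt b A)
decOpt true  d = d
decOpt false d tt tt = yes refl

module GenWreath {n : ℕ} (_≤_ : Rel (Fin n) 0ℓ)
                 (isDPO : IsDecPartialOrder _≡_ _≤_)
                 (G : Fin n → FinGroup)
                 (S : (i : Fin n) → FinGroup.Carrier (G i) → Set) where
  open IsDecPartialOrder isDPO using (_≤?_)
  open FinGroup

  inA : Fin n → Fin n → Bool
  inA i j = does (i ≤? j) ∧ not (does (i Fin.≟ j))

  -- ∏_{j ∈ A(i)} G_j  (factors outside A(i) replaced by ⊤)
  Dom : Fin n → Set
  Dom i = Tup n (λ j → Opt (inA i j) (Carrier (G j)))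

  decDom : (i : Fin n) → DecidableEquality (Dom i)
  decDom i = decTup (λ j → decOpt (inA i j) (_≟_ (G j)))

  X : Set
  X = Tup n (λ j → Carrier (G j))

  F : Set
  F = (i : Fin n) → Dom i → Carrier (G i)

  restrict : (i : Fin n) → ((j : Fin n) → Carrier (G j)) → Dom i
  restrict i g = tab (λ j → opt (inA i j) (g j))

  act : F → X → X
  act f x = tab (λ i → _∙_ (G i) (get x i) (f i (restrict i (get x))))

  one : (i : Fin n) → Dom i
  one i = restrict i (λ j → ε (G j))

  sbar : (i : Fin n) → Carrier (G i) → Dom i → Carrier (G i)
  sbar i s p with decDom i p (one i)
  ... | yes _ = s
  ... | no  _ = ε (G i)

  fbar : (i : Fin n) → Carrier (G i) → F
  fbar i s q p with q Fin.≟ i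
  ... | yes refl = sbar i s p
  ... | no  _    = ε (G q)

  Gen : Set
  Gen = Σ[ i ∈ Fin n ] Σ[ s ∈ Carrier (G i) ] S i s

  genElt : Gen → F
  genElt (i , s , _) = fbar i s

  -- S generates G: every element of G (as a permutation of X) is a
  -- product t₁ t₂ ⋯ t_k of elements of S, with x(fh) = (xf)h.
  SGenerates : Set
  SGenerates = ∀ (f : F) → Σ[ ws ∈ List Gen ]
                 ∀ (x : X) → act f x ≡ foldl (λ y w → act (genElt w) y) x ws

  -- Cay(G,S): f ~ h iff h = f t for some t ∈ S (product in G =
  -- composition of permutations of X, written on the right)
  CayAdj : F → F → Set
  CayAdj f h = Σ[ w ∈ Gen ] ∀ (x : X) → act h x ≡ act (genElt w) (act f x)

  -- e_j(f) = f_j((e_k(f)⁻¹)_{k ∈ A(j)}), computed by iterating the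
  -- recursion; n rounds suffice since every chain above j has < n elements.
  eIter : ℕ → F → (j : Fin n) → Carrier (G j)
  eIter zero    f j = ε (G j)
  eIter (suc m) f j = f j (restrict j (λ k → _⁻¹ (G k) (eIter m f k)))

  e : F → (j : Fin n) → Carrier (G j)
  e f = eIter n f

  pt : F → (i : Fin n) → Dom i
  pt f i = restrict i (λ k → _⁻¹ (G k) (e f k))

  CayAdjᵢ : (i : Fin n) → Carrier (G i) → Carrier (G i) → Set
  CayAdjᵢ i a b = Σ[ s ∈ Carrier (G i) ] S i s × b ≡ _∙_ (G i) a s

  WAdj : F → F → Set
  WAdj f h = Σ[ i ∈ Fin n ]
      ( (∀ (j : Fin n) → j ≢ i → ∀ (q : Dom j) → f j q ≡ h j q)
      × (∀ (q : Dom i) → q ≢ pt f i → f i q ≡ h i q)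
      × CayAdjᵢ i (f i (pt f i)) (h i (pt f i)) )

-- A point x is sent by f to a point with trivial A(i)-coordinates exactly when
-- x_{A(i)} = (e_k(f)⁻¹)_k (induction down the poset, using e_k(f) = f_k(...)). Hence
-- composing f with the generator fbar_{i,s} multiplies f_i by s at that single point and
-- changes nothing else, which is precisely a step of the generalized wreath product graph.
-- For generation, an element of G is a product of elements supported on one coordinate
-- each (peeling off a maximal coordinate at a time); such an element is a product of
-- "spikes" with value a at one point q, each a product of spikes with values in S_i; and
-- the spike with value s at q is the conjugate of fbar_{i,s} by the translation by q,
-- which is supported strictly above i and so is generated by induction on |A(i)|.

module Submission where

open import Defs
open import Level using (0ℓ)
open import Data.Nat using (ℕ; zero; suc; _<_; s≤s)
open import Data.Nat.Properties using (≤-trans; ≤-pred)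
open import Data.Fin using (Fin; zero; suc)
open import Data.Fin.Properties using (any?)
import Data.Fin as Fin
open import Data.Fin.Subset using (Subset; _∈_; _∉_; _⊂_; ⊤; _-_; ∣_∣)
open import Data.Fin.Subset.Properties
  using (_∈?_; ∈⊤; nonempty?; x∈p∧x≢y⇒x∈p-y; p─q⊆p; ∣⊤∣≡n; ∣p∣≤n; p⊂q⇒∣p∣<∣q∣; x∈p⇒∣p-x∣<∣p∣)
open import Data.Bool using (true; false)
import Data.Bool as Bool
open import Data.Unit using (tt)
open import Data.Product using (_×_; _,_; proj₁; proj₂; Σ-syntax)
open import Data.List using (List; []; _∷_; foldr; foldl; map; allFin; cartesianProduct; _++_)
open import Data.List.Properties using (foldl-++)
open import Data.List.Membership.Propositional using () renaming (_∈_ to _∈ₗ_; _∉_ to _∉ₗ_)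
open import Data.List.Membership.Propositional.Properties using (∈-map⁺; ∈-allFin; ∈-cartesianProduct⁺)
open import Data.List.Relation.Unary.Any using (here; there)
open import Data.Vec using (_∷_; tabulate)
import Data.Vec as Vec
open import Data.Vec.Properties using (lookup∘tabulate; []=⇒lookup; lookup⇒[]=)
open import Relation.Nullary using (Dec; yes; no; contradiction)
open import Relation.Nullary.Decidable using (_×-dec_)
open import Relation.Binary using (Rel; IsDecPartialOrder)
open import Relation.Binary.PropositionalEquality
  using (_≡_; refl; sym; trans; cong; cong₂; subst; _≢_; module ≡-Reasoning)
open import Algebra.Bundles using (Group)
open import Algebra.Structures using (IsGroup)
import Algebra.Properties.Group as GroupProperties
open import Function.Bundles using (_⇔_; mk⇔; Inverse; Equivalence)
open import Function.Construct.Composition using (_⇔-∘_)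
open import Function.Construct.Symmetry using (⇔-sym)


get-tab : ∀ {n} {A : Fin n → Set} (g : (j : Fin n) → A j) j → get {A = A} (tab g) j ≡ g j
get-tab {suc n} g zero    = refl
get-tab {suc n} g (suc j) = get-tab (λ j → g (suc j)) j

tab-get : ∀ {n} {A : Fin n → Set} (t : Tup n A) → tab (get t) ≡ t
tab-get {zero}  tt      = refl
tab-get {suc n} (a , t) = cong (a ,_) (tab-get t)

tab-cong : ∀ {n} {A : Fin n → Set} {g h : (j : Fin n) → A j} →
           (∀ j → g j ≡ h j) → tab {A = A} g ≡ tab h
tab-cong {zero}  g≗h = refl
tab-cong {suc n} g≗h = cong₂ _,_ (g≗h zero) (tab-cong (λ j → g≗h (suc j)))

Tup-ext : ∀ {n} {A : Fin n → Set} {t u : Tup n A} → (∀ j → get t j ≡ get u j) → t ≡ u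
Tup-ext {t = t} {u} t≗u = trans (sym (tab-get t)) (trans (tab-cong t≗u) (tab-get u))

allTup : ∀ {n} {A : Fin n → Set} → ((j : Fin n) → List (A j)) → List (Tup n A)
allTup {zero}  xs = tt ∷ []
allTup {suc n} xs = cartesianProduct (xs zero) (allTup (λ j → xs (suc j)))

∈-allTup : ∀ {n} {A : Fin n → Set} {xs : (j : Fin n) → List (A j)} →
           (∀ j a → a ∈ₗ xs j) → ∀ t → t ∈ₗ allTup xs
∈-allTup {zero}  complete tt      = here refl
∈-allTup {suc n} complete (a , t) =
  ∈-cartesianProduct⁺ (complete zero a) (∈-allTup (λ j → complete (suc j)) t)

opt-cong : ∀ b {A : Set} {a a′ : A} → (b ≡ true → a ≡ a′) → opt b a ≡ opt b a′
opt-cong true  a≡a′ = a≡a′ refl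
opt-cong false a≡a′ = refl

opt-injective : ∀ {b} {A : Set} {a a′ : A} → b ≡ true → opt b a ≡ opt b a′ → a ≡ a′
opt-injective refl a≡a′ = a≡a′

fromOpt : ∀ b {A : Set} → A → Opt b A → A
fromOpt true  d a  = a
fromOpt false d tt = d

opt-fromOpt : ∀ b {A : Set} (d : A) (v : Opt b A) → opt b (fromOpt b d v) ≡ v
opt-fromOpt true  d v  = refl
opt-fromOpt false d tt = refl

fromOpt-false : ∀ {b} {A : Set} (d : A) (v : Opt b A) → b ≡ false → fromOpt b d v ≡ d
fromOpt-false d tt refl = refl

allOpt : ∀ b {A : Set} → List A → List (Opt b A)
allOpt true  xs = xs
allOpt false xs = tt ∷ []

∈-allOpt : ∀ b {A : Set} {xs : List A} → (∀ a → a ∈ₗ xs) → ∀ v → v ∈ₗ allOpt b xs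
∈-allOpt true  complete v  = complete v
∈-allOpt false complete tt = here refl

elements : (H : FinGroup) → List (FinGroup.Carrier H)
elements H = map (Inverse.from (FinGroup.enum H)) (allFin (FinGroup.size H))

∈-elements : ∀ H a → a ∈ₗ elements H
∈-elements H a = subst (_∈ₗ elements H) (Inverse.strictlyInverseʳ (FinGroup.enum H) a)
  (∈-map⁺ (Inverse.from (FinGroup.enum H)) (∈-allFin _))

x∉p-x : ∀ {n} (p : Subset n) x → x ∉ p - x
x∉p-x (_ ∷ p) zero    ()
x∉p-x (_ ∷ p) (suc x) (Vec.there x∈p-x) = x∉p-x p x x∈p-x

toGroup : FinGroup → Group 0ℓ 0ℓ
toGroup H = record { isGroup = FinGroup.isGroup H }

module WreathProduct {n : ℕ} (_≤_ : Rel (Fin n) 0ℓ) (isDPO : IsDecPartialOrder _≡_ _≤_)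
                     (G : Fin n → FinGroup) (S : (i : Fin n) → FinGroup.Carrier (G i) → Set) where
  open GenWreath _≤_ isDPO G S
  open IsDecPartialOrder isDPO using (_≤?_; antisym) renaming (trans to ≤-trans′)
  open ≡-Reasoning

  Car : Fin n → Set
  Car j = FinGroup.Carrier (G j)

  infixl 7 _·_
  infix  8 _⁻¹ᵍ

  _·_ : ∀ {j} → Car j → Car j → Car j
  _·_ {j} = FinGroup._∙_ (G j)

  _⁻¹ᵍ : ∀ {j} → Car j → Car j
  _⁻¹ᵍ {j} = FinGroup._⁻¹ (G j)

  1ᵍ : ∀ {j} → Car j
  1ᵍ {j} = FinGroup.ε (G j)

  module _ {j : Fin n} where
    open IsGroup (FinGroup.isGroup (G j)) public
      using (assoc; identityˡ; identityʳ; inverseˡ)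
    open GroupProperties (toGroup (G j)) public
      using (∙-cancelˡ; inverseˡ-unique; ε⁻¹≈ε; ⁻¹-involutive)

  inA-sound : ∀ {i j} → inA i j ≡ true → i ≤ j × i ≢ j
  inA-sound {i} {j} with i ≤? j | i Fin.≟ j
  ... | yes i≤j | no i≢j = λ _ → i≤j , i≢j
  ... | yes _   | yes _  = λ ()
  ... | no _    | _      = λ ()

  inA-complete : ∀ {i j} → i ≤ j → i ≢ j → inA i j ≡ true
  inA-complete {i} {j} i≤j i≢j with i ≤? j | i Fin.≟ j
  ... | yes _   | no _    = refl
  ... | yes _   | yes i≡j = contradiction i≡j i≢j
  ... | no i≰j  | _       = contradiction i≤j i≰j

  inA-irrefl : ∀ i → inA i i ≡ false
  inA-irrefl i with inA i i in eq
  ... | true  = contradiction refl (proj₂ (inA-sound eq))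
  ... | false = refl

  inA-trans : ∀ {i j k} → inA i j ≡ true → inA j k ≡ true → inA i k ≡ true
  inA-trans ij jk with inA-sound ij | inA-sound jk
  ... | i≤j , i≢j | j≤k , _ =
    inA-complete (≤-trans′ i≤j j≤k) λ { refl → i≢j (antisym i≤j j≤k) }

  inA-≢ : ∀ {i k} → inA i k ≡ true → k ≢ i
  inA-≢ ik k≡i = proj₂ (inA-sound ik) (sym k≡i)

  above : Fin n → Subset n
  above i = tabulate (inA i)

  ∈above⁺ : ∀ {i j} → inA i j ≡ true → j ∈ above i
  ∈above⁺ {i} {j} ij = lookup⇒[]= j (above i) (trans (lookup∘tabulate (inA i) j) ij)

  ∈above⁻ : ∀ {i j} → j ∈ above i → inA i j ≡ true
  ∈above⁻ {i} {j} j∈ = trans (sym (lookup∘tabulate (inA i) j)) ([]=⇒lookup j∈)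

  j∉above-j : ∀ j → j ∉ above j
  j∉above-j j j∈ with trans (sym (∈above⁻ j∈)) (inA-irrefl j)
  ... | ()

  above-⊂ : ∀ {i j} → inA i j ≡ true → above j ⊂ above i
  above-⊂ {j = j} ij =
    (λ k∈ → ∈above⁺ (inA-trans ij (∈above⁻ k∈))) , j , ∈above⁺ ij , j∉above-j j

  rank : Fin n → ℕ
  rank i = ∣ above i ∣

  rank-< : ∀ {i j} → inA i j ≡ true → rank j < rank i
  rank-< ij = p⊂q⇒∣p∣<∣q∣ (above-⊂ ij)

  rank-above< : ∀ {i k m} → inA i k ≡ true → rank i < suc m → rank k < m
  rank-above< ik r = ≤-trans (rank-< ik) (≤-pred r)

  rank<n : ∀ i → rank i < n
  rank<n i =
    subst (rank i <_) (∣⊤∣≡n n) (p⊂q⇒∣p∣<∣q∣ ((λ _ → ∈⊤) , i , ∈⊤ , j∉above-j i))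

  restrict-cong : ∀ i {g h : (j : Fin n) → Car j} →
                  (∀ k → inA i k ≡ true → g k ≡ h k) → restrict i g ≡ restrict i h
  restrict-cong i g≗h = tab-cong λ k → opt-cong (inA i k) (g≗h k)

  restrict-injective : ∀ i {g h : (j : Fin n) → Car j} →
                       restrict i g ≡ restrict i h → ∀ k → inA i k ≡ true → g k ≡ h k
  restrict-injective i {g} {h} g≡h k ik = opt-injective ik (begin
    opt (inA i k) (g k)          ≡⟨ get-tab (λ j → opt (inA i j) (g j)) k ⟨
    get (restrict i g) k         ≡⟨ cong (λ t → get t k) g≡h ⟩
    get (restrict i h) k         ≡⟨ get-tab (λ j → opt (inA i j) (h j)) k ⟩
    opt (inA i k) (h k)          ∎)

  lift : (i : Fin n) → Dom i → (j : Fin n) → Car j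
  lift i q j = fromOpt (inA i j) 1ᵍ (get q j)

  restrict-lift : ∀ i q → restrict i (lift i q) ≡ q
  restrict-lift i q = trans (tab-cong λ j → opt-fromOpt (inA i j) 1ᵍ (get q j)) (tab-get q)

  lift-outside : ∀ i q k → inA i k ≡ false → lift i q k ≡ 1ᵍ
  lift-outside i q k = fromOpt-false 1ᵍ (get q k)

  realize : (i : Fin n) → Dom i → X
  realize i q = tab (lift i q)

  restrict-realize : ∀ i q → restrict i (get (realize i q)) ≡ q
  restrict-realize i q = trans (restrict-cong i λ k _ → get-tab (lift i q) k) (restrict-lift i q)

  get-act : ∀ f x j → get (act f x) j ≡ get x j · f j (restrict j (get x))
  get-act f x = get-tab λ j → get x j · f j (restrict j (get x))

  act-cong : ∀ {f h : F} → (∀ j q → f j q ≡ h j q) → ∀ x → act f x ≡ act h x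
  act-cong f≗h x = tab-cong λ j → cong (get x j ·_) (f≗h j _)

  get-act-trivialAt : ∀ {f : F} {j} → (∀ q → f j q ≡ 1ᵍ) → ∀ x → get (act f x) j ≡ get x j
  get-act-trivialAt {f} {j} fj≗1 x =
    trans (get-act f x j) (trans (cong (get x j ·_) (fj≗1 _)) (identityʳ _))

  act-trivial : ∀ {f : F} → (∀ j q → f j q ≡ 1ᵍ) → ∀ x → act f x ≡ x
  act-trivial f≗1 x = Tup-ext λ j → get-act-trivialAt (f≗1 j) x

  act-injective : ∀ {f h : F} → (∀ x → act f x ≡ act h x) → ∀ j q → f j q ≡ h j q
  act-injective {f} {h} f≗h j q =
    subst (λ p → f j p ≡ h j p) (restrict-realize j q) (∙-cancelˡ (get x j) _ _ (begin
      get x j · f j (restrict j (get x)) ≡⟨ get-act f x j ⟨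
      get (act f x) j                    ≡⟨ cong (λ t → get t j) (f≗h x) ⟩
      get (act h x) j                    ≡⟨ get-act h x j ⟩
      get x j · h j (restrict j (get x)) ∎))
    where x = realize j q

  e-stable : ∀ m f k → rank k < m → eIter m f k ≡ eIter (suc m) f k
  e-stable (suc m) f k r = cong (f k) (restrict-cong k λ l kl →
    cong _⁻¹ᵍ (e-stable m f l (rank-above< kl r)))

  e-fixpoint : ∀ f k → e f k ≡ f k (pt f k)
  e-fixpoint f k = e-stable n f k (rank<n k)

  act-at-pt : ∀ f x k → restrict k (get x) ≡ pt f k → get (act f x) k ≡ get x k · e f k
  act-at-pt f x k x≡pt = begin
    get (act f x) k                    ≡⟨ get-act f x k ⟩
    get x k · f k (restrict k (get x)) ≡⟨ cong (λ p → get x k · f k p) x≡pt ⟩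
    get x k · f k (pt f k)             ≡⟨ cong (get x k ·_) (e-fixpoint f k) ⟨
    get x k · e f k                    ∎

  restrict-act≡one⇔ : ∀ f i x → restrict i (get (act f x)) ≡ one i ⇔ restrict i (get x) ≡ pt f i
  restrict-act≡one⇔ f i x = mk⇔
    (λ fx≡one → restrict-cong i λ k ik → from-one fx≡one n k ik (rank<n k))
    (λ x≡pt → restrict-cong i λ k ik → let x≗e⁻¹ = restrict-injective i x≡pt in begin
      get (act f x) k        ≡⟨ act-at-pt f x k (restrict-cong k λ l kl → x≗e⁻¹ l (inA-trans ik kl)) ⟩
      get x k · e f k        ≡⟨ cong (_· e f k) (x≗e⁻¹ k ik) ⟩
      e f k ⁻¹ᵍ · e f k      ≡⟨ inverseˡ (e f k) ⟩
      1ᵍ                     ∎)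
    where
    from-one : restrict i (get (act f x)) ≡ one i →
               ∀ m k → inA i k ≡ true → rank k < m → get x k ≡ e f k ⁻¹ᵍ
    from-one fx≡one (suc m) k ik r = inverseˡ-unique _ _ (trans
      (sym (act-at-pt f x k (restrict-cong k λ l kl →
        from-one fx≡one m l (inA-trans ik kl) (rank-above< kl r))))
      (restrict-injective i fx≡one k ik))

  single : (i : Fin n) → (Dom i → Car i) → F
  single i g j with j Fin.≟ i
  ... | yes refl = g
  ... | no  _    = λ _ → 1ᵍ

  single-≡ : ∀ i g q → single i g i q ≡ g q
  single-≡ i g q with i Fin.≟ i
  ... | yes refl = refl
  ... | no  i≢i  = contradiction refl i≢i

  single-≢ : ∀ {i j} g q → j ≢ i → single i g j q ≡ 1ᵍ
  single-≢ {i} {j} g q j≢i with j Fin.≟ i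
  ... | yes j≡i = contradiction j≡i j≢i
  ... | no  _   = refl

  spike : (i : Fin n) → Dom i → Car i → Dom i → Car i
  spike i q a p with decDom i p q
  ... | yes _ = a
  ... | no  _ = 1ᵍ

  spike-≡ : ∀ i q a → spike i q a q ≡ a
  spike-≡ i q a with decDom i q q
  ... | yes _   = refl
  ... | no  q≢q = contradiction refl q≢q

  spike-≢ : ∀ i {q p} a → p ≢ q → spike i q a p ≡ 1ᵍ
  spike-≢ i {q} {p} a p≢q with decDom i p q
  ... | yes p≡q = contradiction p≡q p≢q
  ... | no  _   = refl

  spike-resp : ∀ i {q q′ p p′} a → p ≡ q ⇔ p′ ≡ q′ → spike i q a p ≡ spike i q′ a p′
  spike-resp i {q} {q′} {p} {p′} a p≡q⇔p′≡q′ with decDom i p q | decDom i p′ q′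
  ... | yes _   | yes _     = refl
  ... | no  _   | no  _     = refl
  ... | yes p≡q | no  p′≢q′ = contradiction (Equivalence.to p≡q⇔p′≡q′ p≡q) p′≢q′
  ... | no  p≢q | yes p′≡q′ = contradiction (Equivalence.from p≡q⇔p′≡q′ p′≡q′) p≢q

  fbar≗single-spike : ∀ i s j p → fbar i s j p ≡ single i (spike i (one i) s) j p
  fbar≗single-spike i s j p with j Fin.≟ i
  ... | no  _    = refl
  ... | yes refl with decDom i p (one i)
  ...   | yes _ = refl
  ...   | no  _ = refl

  infix 4 _≈F_
  _≈F_ : F → F → Set
  f ≈F h = ∀ j q → f j q ≡ h j q

  infixl 7 _⊙_
  _⊙_ : F → F → F
  (f ⊙ g) j q = f j q · g j q

  mulGen : F → Gen → F
  mulGen f (i , s , _) = f ⊙ single i (spike i (pt f i) s)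

  act-fbar-act : ∀ f i s x → act (fbar i s) (act f x) ≡ act (f ⊙ single i (spike i (pt f i) s)) x
  act-fbar-act f i s x = Tup-ext λ j → begin
    get (act (fbar i s) (act f x)) j
      ≡⟨ get-act (fbar i s) (act f x) j ⟩
    get (act f x) j · fbar i s j (restrict j (get (act f x)))
      ≡⟨ cong₂ _·_ (get-act f x j) (trans (fbar≗single-spike i s j _) (moved j (j Fin.≟ i))) ⟩
    get x j · f j (restrict j (get x)) · single i (spike i (pt f i) s) j (restrict j (get x))
      ≡⟨ assoc _ _ _ ⟩
    get x j · (f ⊙ single i (spike i (pt f i) s)) j (restrict j (get x))
      ≡⟨ get-act (f ⊙ single i (spike i (pt f i) s)) x j ⟨
    get (act (f ⊙ single i (spike i (pt f i) s)) x) j ∎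
    where
    moved : ∀ j → Dec (j ≡ i) → single i (spike i (one i) s) j (restrict j (get (act f x)))
                               ≡ single i (spike i (pt f i) s) j (restrict j (get x))
    moved j (no j≢i) = trans (single-≢ _ _ j≢i) (sym (single-≢ _ _ j≢i))
    moved j (yes refl) = begin
      single i (spike i (one i) s) i (restrict i (get (act f x))) ≡⟨ single-≡ i _ _ ⟩
      spike i (one i) s (restrict i (get (act f x)))             ≡⟨ spike-resp i s (restrict-act≡one⇔ f i x) ⟩
      spike i (pt f i) s (restrict i (get x))                    ≡⟨ single-≡ i _ _ ⟨
      single i (spike i (pt f i) s) i (restrict i (get x))       ∎

  mulGen-≢ : ∀ f i s Ss {j} q → j ≢ i → mulGen f (i , s , Ss) j q ≡ f j q
  mulGen-≢ f i s Ss q j≢i = trans (cong (f _ q ·_) (single-≢ _ q j≢i)) (identityʳ _)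

  mulGen-off : ∀ f i s Ss q → q ≢ pt f i → mulGen f (i , s , Ss) i q ≡ f i q
  mulGen-off f i s Ss q q≢p =
    trans (cong (f i q ·_) (trans (single-≡ i _ q) (spike-≢ i s q≢p))) (identityʳ _)

  mulGen-pt : ∀ f i s Ss → mulGen f (i , s , Ss) i (pt f i) ≡ f i (pt f i) · s
  mulGen-pt f i s Ss = cong (f i (pt f i) ·_) (trans (single-≡ i _ _) (spike-≡ i _ s))

  CayAdj⇔mulGen : ∀ f h → CayAdj f h ⇔ (Σ[ w ∈ Gen ] h ≈F mulGen f w)
  CayAdj⇔mulGen f h = mk⇔
    (λ (w , h≡wf) → w , act-injective λ x → trans (h≡wf x) (act-fbar-act f _ _ x))
    (λ (w , h≈) → w , λ x → trans (act-cong h≈ x) (sym (act-fbar-act f _ _ x)))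

  WAdj⇔mulGen : ∀ f h → WAdj f h ⇔ (Σ[ w ∈ Gen ] h ≈F mulGen f w)
  WAdj⇔mulGen f h = mk⇔
    (λ (i , others , offPt , s , Ss , atPt) → (i , s , Ss) , λ j q →
       pointwise i s Ss others offPt atPt j q (j Fin.≟ i))
    (λ ((i , s , Ss) , h≈) →
       i , (λ j j≢i q → sym (trans (h≈ j q) (mulGen-≢ f i s Ss q j≢i)))
         , (λ q q≢p → sym (trans (h≈ i q) (mulGen-off f i s Ss q q≢p)))
         , s , Ss , trans (h≈ i (pt f i)) (mulGen-pt f i s Ss))
    where
    pointwise : ∀ i s Ss → (∀ j → j ≢ i → ∀ q → f j q ≡ h j q) →
                (∀ q → q ≢ pt f i → f i q ≡ h i q) → h i (pt f i) ≡ f i (pt f i) · s →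
                ∀ j q → Dec (j ≡ i) → h j q ≡ mulGen f (i , s , Ss) j q
    pointwise i s Ss others offPt atPt j q (no j≢i) =
      trans (sym (others j j≢i q)) (sym (mulGen-≢ f i s Ss q j≢i))
    pointwise i s Ss others offPt atPt .i q (yes refl) with decDom i q (pt f i)
    ... | yes refl = trans atPt (sym (mulGen-pt f i s Ss))
    ... | no  q≢p  = trans (sym (offPt q q≢p)) (sym (mulGen-off f i s Ss q q≢p))

  WAdj⇔CayAdj : ∀ f h → WAdj f h ⇔ CayAdj f h
  WAdj⇔CayAdj f h = ⇔-sym (CayAdj⇔mulGen f h) ⇔-∘ WAdj⇔mulGen f h

  restrict-act-frame : ∀ {f : F} i → (∀ k → inA i k ≡ true → ∀ q → f k q ≡ 1ᵍ) →
                       ∀ x → restrict i (get (act f x)) ≡ restrict i (get x)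
  restrict-act-frame i f≗1 x = restrict-cong i λ k ik → get-act-trivialAt (f≗1 k ik) x

  single-cong : ∀ i {g h} → (∀ p → g p ≡ h p) → single i g ≈F single i h
  single-cong i g≗h j q with j Fin.≟ i
  ... | yes refl = g≗h q
  ... | no  _    = refl

  single-1 : ∀ i j q → single i (λ _ → 1ᵍ) j q ≡ 1ᵍ
  single-1 i j q with j Fin.≟ i
  ... | yes refl = refl
  ... | no  _    = refl

  act-single-trivial : ∀ i {g} → (∀ p → g p ≡ 1ᵍ) → ∀ x → act (single i g) x ≡ x
  act-single-trivial i g≗1 = act-trivial λ j q → trans (single-cong i g≗1 j q) (single-1 i j q)

  act-single-⊙ : ∀ i g h x → act (single i h) (act (single i g) x) ≡ act (single i (λ p → g p · h p)) x
  act-single-⊙ i g h x = Tup-ext λ j → coordinate j (j Fin.≟ i)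
    where
    y = act (single i g) x
    coordinate : ∀ j → Dec (j ≡ i) →
                 get (act (single i h) y) j ≡ get (act (single i (λ p → g p · h p)) x) j
    coordinate j (no j≢i) = begin
      get (act (single i h) y) j                     ≡⟨ get-act-trivialAt (λ q → single-≢ h q j≢i) y ⟩
      get y j                                        ≡⟨ get-act-trivialAt (λ q → single-≢ g q j≢i) x ⟩
      get x j                                        ≡⟨ get-act-trivialAt (λ q → single-≢ _ q j≢i) x ⟨
      get (act (single i (λ p → g p · h p)) x) j     ∎
    coordinate j (yes refl) = begin
      get (act (single i h) y) i
        ≡⟨ get-act (single i h) y i ⟩
      get y i · single i h i (restrict i (get y))
        ≡⟨ cong₂ _·_ (get-act (single i g) x i) (trans (single-≡ i h _) (cong h y≡x-above)) ⟩
      get x i · single i g i r · h r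
        ≡⟨ trans (assoc _ _ _) (cong (λ a → get x i · (a · h r)) (single-≡ i g r)) ⟩
      get x i · (g r · h r)
        ≡⟨ cong (get x i ·_) (single-≡ i _ r) ⟨
      get x i · single i (λ p → g p · h p) i r
        ≡⟨ get-act (single i (λ p → g p · h p)) x i ⟨
      get (act (single i (λ p → g p · h p)) x) i ∎
      where
      r = restrict i (get x)
      y≡x-above : restrict i (get y) ≡ r
      y≡x-above = restrict-act-frame i (λ k ik q → single-≢ g q (inA-≢ ik)) x

  run : List Gen → X → X
  run ws x = foldl (λ y w → act (genElt w) y) x ws

  Realizable : (X → X) → Set
  Realizable φ = Σ[ ws ∈ List Gen ] (∀ x → φ x ≡ run ws x)

  realizable-id : Realizable (λ x → x)
  realizable-id = [] , λ _ → refl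

  realizable-∘ : ∀ {φ ψ} → Realizable φ → Realizable ψ → Realizable (λ x → ψ (φ x))
  realizable-∘ {φ} {ψ} (ws , φ≗ws) (vs , ψ≗vs) = ws ++ vs , λ x → begin
    ψ (φ x)         ≡⟨ cong ψ (φ≗ws x) ⟩
    ψ (run ws x)    ≡⟨ ψ≗vs (run ws x) ⟩
    run vs (run ws x) ≡⟨ foldl-++ (λ y w → act (genElt w) y) x ws vs ⟨
    run (ws ++ vs) x ∎

  realizable-cong : ∀ {φ ψ} → (∀ x → φ x ≡ ψ x) → Realizable φ → Realizable ψ
  realizable-cong φ≗ψ (ws , φ≗ws) = ws , λ x → trans (sym (φ≗ψ x)) (φ≗ws x)

  realizable-genElt : ∀ w → Realizable (act (genElt w))
  realizable-genElt w = w ∷ [] , λ _ → refl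

  spike-· : ∀ i q a b p → spike i q (a · b) p ≡ spike i q a p · spike i q b p
  spike-· i q a b p with decDom i p q
  ... | yes _ = refl
  ... | no  _ = sym (identityˡ 1ᵍ)

  spike-1 : ∀ i q p → spike i q 1ᵍ p ≡ 1ᵍ
  spike-1 i q p with decDom i p q
  ... | yes _ = refl
  ... | no  _ = refl

  realizable-spike : ∀ i → IsSymGenSet (G i) (S i) →
                     (∀ q s → S i s → Realizable (act (single i (spike i q s)))) →
                     ∀ q a → Realizable (act (single i (spike i q a)))
  realizable-spike i gensᵢ realizable-gen q a =
    realizable-cong (act-cong (single-cong i λ p → cong (λ b → spike i q b p) (sym a≡ws)))
                    (word ws)
    where
    ws = proj₁ (IsSymGenSet.generates gensᵢ a)
    a≡ws = proj₂ (IsSymGenSet.generates gensᵢ a)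
    word : ∀ ws → Realizable (act (single i (spike i q (foldr (λ w acc → proj₁ w · acc) 1ᵍ ws))))
    word []              =
      realizable-cong (λ x → sym (act-single-trivial i (spike-1 i q) x)) realizable-id
    word ((s , Ss) ∷ ws) = realizable-cong
      (λ x → trans (act-single-⊙ i _ _ x) (act-cong (single-cong i λ p → sym (spike-· i q s _ p)) x))
      (realizable-∘ (realizable-gen q s Ss) (word ws))

  allDom : ∀ i → List (Dom i)
  allDom i = allTup λ j → allOpt (inA i j) (elements (G j))

  ∈-allDom : ∀ i p → p ∈ₗ allDom i
  ∈-allDom i = ∈-allTup λ j → ∈-allOpt (inA i j) (∈-elements (G j))

  realizable-single-from-spikes : ∀ i → (∀ q a → Realizable (act (single i (spike i q a)))) →
                                  ∀ g → Realizable (act (single i g))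
  realizable-single-from-spikes i realizable-spike g =
    supportedOn (allDom i) g λ p p∉ → contradiction (∈-allDom i p) p∉
    where
    supportedOn : ∀ L g → (∀ p → p ∉ₗ L → g p ≡ 1ᵍ) → Realizable (act (single i g))
    supportedOn []      g off =
      realizable-cong (λ x → sym (act-single-trivial i (λ p → off p λ ()) x)) realizable-id
    supportedOn (q ∷ L) g off = realizable-cong
      (λ x → trans (act-single-⊙ i _ _ x) (act-cong (single-cong i restore) x))
      (realizable-∘ (supportedOn L erase off-erase) (realizable-spike q (g q)))
      where
      erase : Dom i → Car i
      erase p with decDom i p q
      ... | yes _ = 1ᵍ
      ... | no  _ = g p
      restore : ∀ p → erase p · spike i q (g q) p ≡ g p
      restore p with decDom i p q
      ... | yes refl = identityˡ _
      ... | no  _    = identityʳ _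
      off-erase : ∀ p → p ∉ₗ L → erase p ≡ 1ᵍ
      off-erase p p∉L with decDom i p q
      ... | yes _   = refl
      ... | no  p≢q = off p λ { (here p≡q) → p≢q p≡q ; (there p∈L) → p∉L p∈L }

  infixl 8 _↾_
  _↾_ : F → Subset n → F
  (f ↾ P) j with j ∈? P
  ... | yes _ = f j
  ... | no  _ = λ _ → 1ᵍ

  ↾-∈ : ∀ f {P j} q → j ∈ P → (f ↾ P) j q ≡ f j q
  ↾-∈ f {P} {j} q j∈P with j ∈? P
  ... | yes _   = refl
  ... | no  j∉P = contradiction j∈P j∉P

  ↾-∉ : ∀ f {P j} q → j ∉ P → (f ↾ P) j q ≡ 1ᵍ
  ↾-∉ f {P} {j} q j∉P with j ∈? P
  ... | yes j∈P = contradiction j∈P j∉P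
  ... | no  _   = refl

  ↾-resp : ∀ f {P Q j} q → j ∈ P ⇔ j ∈ Q → (f ↾ P) j q ≡ (f ↾ Q) j q
  ↾-resp f {P} {Q} {j} q j∈P⇔j∈Q with j ∈? P
  ... | yes j∈P = sym (↾-∈ f q (Equivalence.to j∈P⇔j∈Q j∈P))
  ... | no  j∉P = sym (↾-∉ f q (λ j∈Q → j∉P (Equivalence.from j∈P⇔j∈Q j∈Q)))

  topmost : ∀ m (P : Subset n) i → rank i < m → i ∈ P →
            Σ[ t ∈ Fin n ] (t ∈ P × (∀ k → inA t k ≡ true → k ∉ P))
  topmost (suc m) P i r i∈P with any? (λ k → (inA i k Bool.≟ true) ×-dec (k ∈? P))
  ... | yes (k , ik , k∈P) = topmost m P k (rank-above< ik r) k∈P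
  ... | no  none           = i , i∈P , λ k ik k∈P → none (k , ik , k∈P)

  act-↾-peel : ∀ f P t → t ∈ P → (∀ k → inA t k ≡ true → k ∉ P) →
               ∀ x → act (f ↾ P) x ≡ act (single t (f t)) (act (f ↾ (P - t)) x)
  act-↾-peel f P t t∈P top x = Tup-ext λ j → coordinate j (j Fin.≟ t)
    where
    y = act (f ↾ (P - t)) x
    coordinate : ∀ j → Dec (j ≡ t) → get (act (f ↾ P) x) j ≡ get (act (single t (f t)) y) j
    coordinate j (no j≢t) = begin
      get (act (f ↾ P) x) j                          ≡⟨ get-act (f ↾ P) x j ⟩
      get x j · (f ↾ P) j (restrict j (get x))       ≡⟨ cong (get x j ·_) (↾-resp f _ j∈P⇔j∈P-t) ⟩
      get x j · (f ↾ (P - t)) j (restrict j (get x)) ≡⟨ get-act (f ↾ (P - t)) x j ⟨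
      get y j                                        ≡⟨ get-act-trivialAt (λ q → single-≢ (f t) q j≢t) y ⟨
      get (act (single t (f t)) y) j                 ∎
      where
      j∈P⇔j∈P-t : j ∈ P ⇔ j ∈ P - t
      j∈P⇔j∈P-t = mk⇔ (λ j∈P → x∈p∧x≢y⇒x∈p-y j∈P j≢t) (p─q⊆p P _)
    coordinate j (yes refl) = begin
      get (act (f ↾ P) x) t                           ≡⟨ get-act (f ↾ P) x t ⟩
      get x t · (f ↾ P) t (restrict t (get x))        ≡⟨ cong₂ _·_ (sym yₜ≡xₜ) (↾-∈ f _ t∈P) ⟩
      get y t · f t (restrict t (get x))              ≡⟨ cong (λ p → get y t · f t p) y≡x-above ⟨
      get y t · f t (restrict t (get y))              ≡⟨ cong (get y t ·_) (single-≡ t (f t) _) ⟨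
      get y t · single t (f t) t (restrict t (get y)) ≡⟨ get-act (single t (f t)) y t ⟨
      get (act (single t (f t)) y) t                  ∎
      where
      yₜ≡xₜ : get y t ≡ get x t
      yₜ≡xₜ = get-act-trivialAt {f ↾ (P - t)} (λ q → ↾-∉ f q (x∉p-x P t)) x
      y≡x-above : restrict t (get y) ≡ restrict t (get x)
      y≡x-above = restrict-act-frame t (λ k tk q → ↾-∉ f q λ k∈P-t → top k tk (p─q⊆p P _ k∈P-t)) x

  realizable-act-↾ : ∀ f → (∀ k → Realizable (act (single k (f k)))) →
                     ∀ m P → ∣ P ∣ < m → Realizable (act (f ↾ P))
  realizable-act-↾ f realizable-coord (suc m) P r with nonempty? P
  ... | no  empty =
    realizable-cong (λ x → sym (act-trivial (λ j q → ↾-∉ f q λ j∈P → empty (j , j∈P)) x)) realizable-id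
  ... | yes (i , i∈P) with topmost n P i (rank<n i) i∈P
  ...   | t , t∈P , top = realizable-cong (λ x → sym (act-↾-peel f P t t∈P top x))
    (realizable-∘ (realizable-act-↾ f realizable-coord m (P - t) ∣P-t∣<m) (realizable-coord t))
    where
    ∣P-t∣<m : ∣ P - t ∣ < m
    ∣P-t∣<m = ≤-trans (x∈p⇒∣p-x∣<∣p∣ t∈P) (≤-pred r)

  realizable-act : ∀ f → (∀ k → Realizable (act (single k (f k)))) → Realizable (act f)
  realizable-act f realizable-coord = realizable-cong (act-cong λ j q → ↾-∈ f q ∈⊤)
    (realizable-act-↾ f realizable-coord (suc n) ⊤ (s≤s (∣p∣≤n ⊤)))

  translation : ((j : Fin n) → Car j) → F
  translation y j _ = y j

  pt-translation⁻¹ : ∀ y i → pt (translation λ k → y k ⁻¹ᵍ) i ≡ restrict i y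
  pt-translation⁻¹ y i = restrict-cong i λ k _ →
    trans (cong _⁻¹ᵍ (e-fixpoint (translation λ k → y k ⁻¹ᵍ) k)) (⁻¹-involutive (y k))

  spike-conjugate : ∀ i q s x →
    act (translation (lift i q)) (act (fbar i s) (act (translation λ k → lift i q k ⁻¹ᵍ) x))
      ≡ act (single i (spike i q s)) x
  spike-conjugate i q s x = Tup-ext λ k → begin
      get (act (translation y) (act (fbar i s) (act c x))) k ≡⟨ cong (λ w → get (act (translation y) w) k)
                                                                     (act-fbar-act c i s x) ⟩
      get (act (translation y) z) k                          ≡⟨ get-act (translation y) z k ⟩
      get z k · y k                                          ≡⟨ cong (_· y k) (get-act (c ⊙ σ) x k) ⟩
      get x k · (y k ⁻¹ᵍ · σ k r) · y k                      ≡⟨ coordinate k (k Fin.≟ i) ⟩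
      get x k · single i (spike i q s) k r                   ≡⟨ get-act (single i (spike i q s)) x k ⟨
      get (act (single i (spike i q s)) x) k                 ∎
    where
    y = lift i q
    c = translation λ k → y k ⁻¹ᵍ
    σ = single i (spike i (pt c i) s)
    z = act (c ⊙ σ) x
    r : ∀ {k} → Dom k
    r {k} = restrict k (get x)
    coordinate : ∀ k → Dec (k ≡ i) →
                 get x k · (y k ⁻¹ᵍ · σ k r) · y k ≡ get x k · single i (spike i q s) k r
    coordinate k (no k≢i) = begin
      get x k · (y k ⁻¹ᵍ · σ k r) · y k    ≡⟨ cong (λ a → get x k · (y k ⁻¹ᵍ · a) · y k) (single-≢ _ r k≢i) ⟩
      get x k · (y k ⁻¹ᵍ · 1ᵍ) · y k       ≡⟨ cong (λ a → get x k · a · y k) (identityʳ _) ⟩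
      get x k · y k ⁻¹ᵍ · y k              ≡⟨ trans (assoc _ _ _) (cong (get x k ·_) (inverseˡ _)) ⟩
      get x k · 1ᵍ                         ≡⟨ cong (get x k ·_) (single-≢ _ r k≢i) ⟨
      get x k · single i (spike i q s) k r ∎
    coordinate k (yes refl) = begin
      get x i · (y i ⁻¹ᵍ · σ i r) · y i    ≡⟨ cong (λ a → get x i · (a ⁻¹ᵍ · σ i r) · a) yᵢ≡1 ⟩
      get x i · (1ᵍ ⁻¹ᵍ · σ i r) · 1ᵍ      ≡⟨ trans (identityʳ _) (cong (λ a → get x i · (a · σ i r)) ε⁻¹≈ε) ⟩
      get x i · (1ᵍ · σ i r)               ≡⟨ cong (get x i ·_) (trans (identityˡ _) (single-≡ i _ r)) ⟩
      get x i · spike i (pt c i) s r       ≡⟨ cong (λ p → get x i · spike i p s r) pt≡q ⟩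
      get x i · spike i q s r              ≡⟨ cong (get x i ·_) (single-≡ i _ r) ⟨
      get x i · single i (spike i q s) i r ∎
      where
      yᵢ≡1 : y i ≡ 1ᵍ
      yᵢ≡1 = lift-outside i q i (inA-irrefl i)
      pt≡q : pt c i ≡ q
      pt≡q = trans (pt-translation⁻¹ y i) (restrict-lift i q)

  realizable-translation : ∀ i → (∀ k → inA i k ≡ true → ∀ g → Realizable (act (single k g))) →
                           ∀ y → (∀ k → inA i k ≡ false → y k ≡ 1ᵍ) → Realizable (act (translation y))
  realizable-translation i realizable-above y y-outside = realizable-act (translation y) coord
    where
    coord : ∀ k → Realizable (act (single k (λ _ → y k)))
    coord k with inA i k in ik
    ... | true  = realizable-above k ik _
    ... | false = realizable-cong (λ x → sym (act-single-trivial k (λ _ → y-outside k ik) x)) realizable-id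

  realizable-single : (∀ i → IsSymGenSet (G i) (S i)) →
                      ∀ m i → rank i < m → ∀ g → Realizable (act (single i g))
  realizable-single gens (suc m) i r =
    realizable-single-from-spikes i (realizable-spike i (gens i) λ q s Ss →
      realizable-cong (spike-conjugate i q s)
        (realizable-∘ (realizable-∘ (translate (λ k → lift i q k ⁻¹ᵍ) (lift⁻¹-outside q))
                                    (realizable-genElt (i , s , Ss)))
                      (translate (lift i q) (lift-outside i q))))
    where
    translate : ∀ y → (∀ k → inA i k ≡ false → y k ≡ 1ᵍ) → Realizable (act (translation y))
    translate = realizable-translation i λ k ik → realizable-single gens m k (rank-above< ik r)
    lift⁻¹-outside : ∀ q k → inA i k ≡ false → lift i q k ⁻¹ᵍ ≡ 1ᵍ
    lift⁻¹-outside q k ik = trans (cong _⁻¹ᵍ (lift-outside i q k ik)) ε⁻¹≈ε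

  generates : (∀ i → IsSymGenSet (G i) (S i)) → SGenerates
  generates gens f = realizable-act f λ k → realizable-single gens n k (rank<n k) (f k)

theorem3p14 : (n : ℕ) (_≤_ : Rel (Fin n) 0ℓ) (isDPO : IsDecPartialOrder _≡_ _≤_)
    (G : Fin n → FinGroup) (S : (i : Fin n) → FinGroup.Carrier (G i) → Set) →
    ((i : Fin n) → IsSymGenSet (G i) (S i)) →
    GenWreath.SGenerates _≤_ isDPO G S
    × (∀ (f h : GenWreath.F _≤_ isDPO G S) →
         GenWreath.WAdj _≤_ isDPO G S f h ⇔ GenWreath.CayAdj _≤_ isDPO G S f h)
theorem3p14 n _≤_ isDPO G S gens = generates gens , WAdj⇔CayAdj
  where open WreathProduct _≤_ isDPO G S
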